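{- Let $K \geq 2$ and $p \geq 1$ be integers, and let $\sigma$ be a permutation with $\sigma \notin \mathcal{C}(K,p)$. Then either $\sigma$ has size at most $(Kp+2)^2-2$, or there exists a strict pattern $\tau$ of $\sigma$ (a pattern with $|\tau| < |\sigma|$) such that $\tau \notin \mathcal{C}(K,p)$.
   Context: A permutation $\pi \in S_k$ is a pattern of $\sigma \in S_n$ if $\sigma$ has a subsequence order-isomorphic to $\pi$. A duplication-loss step of width $k$ applied to a permutation $\pi$ chooses a contiguous fragment of $k$ consecutive positions and a subset $S$ of its entries, and replaces the fragment by the entries of $S$ in their original relative order followed by the remaining entries of the fragment in their original relative order. $\mathcal{C}(K,p)$ is the class of all permutations (of any size $n$) obtained from the identity $12\ldots n$ after $p$ duplication-loss steps each of width at most $K$. -}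

module Defs where

open import Data.Nat using (ℕ; zero; suc; _+_; _≤_; _<_)
open import Data.Bool using (Bool; true; false; not)
open import Data.List using (List; []; _∷_; _++_; take; drop; length; lookup; upTo; map)
open import Data.List.Relation.Binary.Sublist.Propositional using (_⊆_)
open import Data.List.Relation.Binary.Permutation.Propositional using (_↭_)
open import Data.Fin using (Fin; cast)
open import Data.Product using (Σ; ∃; _×_)
open import Function.Bundles using (_⇔_)
open import Relation.Binary.PropositionalEquality using (_≡_)

-- Permutations are lists of values; a permutation of size n is a list that
-- is a rearrangement of 0,1,…,n-1 (0-based values).
IsPerm : List ℕ → Set
IsPerm σ = σ ↭ upTo (length σ)

identity : ℕ → List ℕ
identity n = upTo n

OrderIso : List ℕ → List ℕ → Set
OrderIso xs ys = Σ (length xs ≡ length ys) λ eq →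
  ∀ (i j : Fin (length xs)) →
    (lookup xs i < lookup xs j) ⇔ (lookup ys (cast eq i) < lookup ys (cast eq j))

IsPattern : List ℕ → List ℕ → Set
IsPattern τ σ = ∃ λ xs → xs ⊆ σ × OrderIso xs τ

select : List Bool → List ℕ → List ℕ
select []          _        = []
select (_ ∷ _)     []       = []
select (true ∷ bs) (x ∷ xs) = x ∷ select bs xs
select (false ∷ bs) (x ∷ xs) = select bs xs

complementMask : List Bool → List Bool
complementMask = map not

applyStep : ℕ → ℕ → List Bool → List ℕ → List ℕ
applyStep i k mask π =
  let frag = take k (drop i π) in
  take i π ++ (select mask frag ++ select (complementMask mask) frag) ++ drop (i + k) π

DLStep : ℕ → List ℕ → List ℕ → Set
DLStep K π π' =
  ∃ λ i → ∃ λ k → ∃ λ (mask : List Bool) →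
    k ≤ K × i + k ≤ length π × length mask ≡ k × π' ≡ applyStep i k mask π

Steps : ℕ → ℕ → List ℕ → List ℕ → Set
Steps K zero    π π' = π ≡ π'
Steps K (suc p) π π' = ∃ λ π₁ → DLStep K π π₁ × Steps K p π₁ π'

InC : ℕ → ℕ → List ℕ → Set
InC K p σ = ∃ λ n → Steps K p (identity n) σ

-- Let m = K p. A duplication-loss step of width at most K rewrites at most K
-- positions, so every permutation in C(K,p) has at most m entries off the
-- diagonal ("misplaced"). Take σ ∉ C(K,p) with more than (m+2)² - 2 entries.
--
-- If σ has more than m misplaced entries, erase a fixed point: no misplaced
-- entry becomes fixed. If σ has no fixed point, all of its at least m + 3
-- entries are misplaced, and erasing an entry one above the diagonal, or else
-- the value 0, makes at most two of them fixed. Either way the resulting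
-- pattern has more than m misplaced entries and lies outside C(K,p).
--
-- Otherwise σ, having at most m misplaced entries among (m+1)² positions,
-- contains a run of m+1 consecutive fixed points; erase the first one to get τ.
-- Re-inserting a fixed point anywhere along the run gives back σ, and each step
-- of a derivation of τ straddles at most K of these m+1 insertion points, so
-- one of them avoids all p steps and lifts the derivation of τ to one of σ.

module Submission where

open import Defs
open import Data.Bool using (Bool; true; false; if_then_else_)
open import Data.Empty using (⊥-elim)
open import Data.Fin using (zero; suc; cast)
open import Data.List using (List; []; _∷_; _++_; take; drop; length; lookup; map; filter; applyUpTo; upTo)
open import Data.List.Properties
  using (length-++; length-map; length-take; length-drop; length-upTo; map-++; map-∘; map-id-local; map-cong-local;
         ++-assoc; take++drop≡id; drop-drop)
open import Data.List.Membership.Propositional using (_∈_)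
open import Data.List.Membership.Propositional.Properties using (∈-lookup; ∈-++⁺ʳ; ∈-∃++; ∈-filter⁻)
open import Data.List.Relation.Binary.Permutation.Propositional using (_↭_; ↭-sym)
open import Data.List.Relation.Binary.Permutation.Propositional.Properties as ↭
  using (drop-mid; All-resp-↭; ∈-resp-↭; ↭-length)
open import Data.List.Relation.Binary.Sublist.Propositional using (⊆-refl; _∷ʳ_)
import Data.List.Relation.Binary.Sublist.Propositional.Properties as Sublist
open import Data.List.Relation.Unary.All as All using (All; []; _∷_)
import Data.List.Relation.Unary.All.Properties as Allₚ
open import Data.List.Relation.Unary.AllPairs using (AllPairs; []; _∷_)
import Data.List.Relation.Unary.AllPairs.Properties as AllPairs
open import Data.List.Relation.Unary.Any using (here; there)
open import Data.Nat
open import Data.Nat.Properties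
open import Algebra.Properties.CommutativeSemigroup +-commutativeSemigroup using (interchange)
open import Data.Nat.Tactic.RingSolver using (solve-∀)
open import Data.Product using (∃; _×_; _,_; proj₁; proj₂)
open import Data.Sum using (_⊎_; inj₁; inj₂)
open import Function using (_∘_)
open import Function.Bundles using (_⇔_; mk⇔)
open import Relation.Binary.Definitions using (tri<; tri≈; tri>)
open import Relation.Binary.PropositionalEquality
open import Relation.Nullary using (¬_; Dec; yes; no; does; ¬?)
open import Relation.Nullary.Decidable using (decidable-stable; _×-dec_; _⊎-dec_)

range : ℕ → ℕ → List ℕ
range a zero    = []
range a (suc n) = a ∷ range (suc a) n

length-range : ∀ a n → length (range a n) ≡ n
length-range a zero    = refl
length-range a (suc n) = cong suc (length-range (suc a) n)

range-++ : ∀ a m n → range a (m + n) ≡ range a m ++ range (a + m) n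
range-++ a zero    n = cong (λ b → range b n) (sym (+-identityʳ a))
range-++ a (suc m) n = cong (a ∷_) (begin
  range (suc a) (m + n)                  ≡⟨ range-++ (suc a) m n ⟩
  range (suc a) m ++ range (suc a + m) n ≡⟨ cong (λ b → range (suc a) m ++ range b n) (sym (+-suc a m)) ⟩
  range (suc a) m ++ range (a + suc m) n ∎)
  where open ≡-Reasoning

range-split : ∀ a {m n} → m ≤ n → range a n ≡ range a m ++ range (a + m) (n ∸ m)
range-split a {m} {n} m≤n = trans (cong (range a) (sym (m+[n∸m]≡n m≤n))) (range-++ a m (n ∸ m))

range-around : ∀ a {t m} → t < m → range a m ≡ range a t ++ (a + t) ∷ range (suc (a + t)) (m ∸ suc t)
range-around a {t} t<m = trans (range-split a (<⇒≤ t<m)) (cong (λ k → range a t ++ range (a + t) k) (+-∸-assoc 1 t<m))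

range-∷ʳ : ∀ j r (xs : List ℕ) → range j r ++ (j + r) ∷ xs ≡ range j (suc r) ++ xs
range-∷ʳ j r xs = begin
  range j r ++ range (j + r) 1 ++ xs  ≡⟨ sym (++-assoc (range j r) _ xs) ⟩
  (range j r ++ range (j + r) 1) ++ xs ≡⟨ cong (_++ xs) (sym (range-++ j r 1)) ⟩
  range j (r + 1) ++ xs               ≡⟨ cong (λ n → range j n ++ xs) (+-comm r 1) ⟩
  range j (suc r) ++ xs               ∎
  where open ≡-Reasoning

applyUpTo≗range : ∀ (f : ℕ → ℕ) a n → (∀ i → f i ≡ a + i) → applyUpTo f n ≡ range a n
applyUpTo≗range f a zero    f≗a+ = refl
applyUpTo≗range f a (suc n) f≗a+ = cong₂ _∷_ (trans (f≗a+ 0) (+-identityʳ a))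
  (applyUpTo≗range (f ∘ suc) (suc a) n (λ i → trans (f≗a+ (suc i)) (+-suc a i)))

upTo≡range : ∀ n → upTo n ≡ range 0 n
upTo≡range n = applyUpTo≗range (λ i → i) 0 n (λ _ → refl)

∈-range⁻ : ∀ {x} a n → x ∈ range a n → a ≤ x × x < a + n
∈-range⁻ a (suc n) (here refl) = ≤-refl , m<m+n a z<s
∈-range⁻ a (suc n) (there x∈) with ∈-range⁻ (suc a) n x∈
... | a<x , x<1+a+n = <⇒≤ a<x , ≤-trans x<1+a+n (≤-reflexive (sym (+-suc a n)))

All-range⁺ : ∀ {P : ℕ → Set} a n → (∀ {x} → a ≤ x → x < a + n → P x) → All P (range a n)
All-range⁺ a n inside⇒P = All.tabulate (λ x∈ → let (a≤x , x<a+n) = ∈-range⁻ a n x∈ in inside⇒P a≤x x<a+n)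

range-sorted : ∀ a n → AllPairs _<_ (range a n)
range-sorted a zero    = []
range-sorted a (suc n) = All-range⁺ (suc a) n (λ a<x _ → a<x) ∷ range-sorted (suc a) n

indicator : {A : Set} → Dec A → ℕ
indicator a? = if does a? then 1 else 0

indicator-≤-+ : ∀ {A B C : Set} (a? : Dec A) (b? : Dec B) (c? : Dec C) →
  (A → ¬ B → C) → indicator a? ≤ indicator b? + indicator c?
indicator-≤-+ (no _)  _       _       _     = z≤n
indicator-≤-+ (yes _) (yes _) _       _     = s≤s z≤n
indicator-≤-+ (yes a) (no ¬b) (yes _) _     = s≤s z≤n
indicator-≤-+ (yes a) (no ¬b) (no ¬c) a¬b⇒c = ⊥-elim (¬c (a¬b⇒c a ¬b))

indicator≤1 : ∀ {A : Set} (a? : Dec A) → indicator a? ≤ 1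
indicator≤1 (yes _) = s≤s z≤n
indicator≤1 (no _)  = z≤n

indicator-no : ∀ {A : Set} (a? : Dec A) → ¬ A → indicator a? ≡ 0
indicator-no (yes a) ¬a = ⊥-elim (¬a a)
indicator-no (no _)  _  = refl

countAt : {Q : ℕ → ℕ → Set} → (∀ x j → Dec (Q x j)) → ℕ → List ℕ → ℕ
countAt Q? j []       = 0
countAt Q? j (x ∷ xs) = indicator (Q? x j) + countAt Q? (suc j) xs

module _ {Q : ℕ → ℕ → Set} (Q? : ∀ x j → Dec (Q x j)) where

  countAt-++ : ∀ j xs ys → countAt Q? j (xs ++ ys) ≡ countAt Q? j xs + countAt Q? (j + length xs) ys
  countAt-++ j []       ys = cong (λ k → countAt Q? k ys) (sym (+-identityʳ j))
  countAt-++ j (x ∷ xs) ys = begin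
    b + countAt Q? (suc j) (xs ++ ys)                                     ≡⟨ cong (b +_) (countAt-++ (suc j) xs ys) ⟩
    b + (countAt Q? (suc j) xs + countAt Q? (suc j + length xs) ys)       ≡⟨ sym (+-assoc b _ _) ⟩
    b + countAt Q? (suc j) xs + countAt Q? (suc j + length xs) ys         ≡⟨ cong (λ k → b + countAt Q? (suc j) xs + countAt Q? k ys) (sym (+-suc j (length xs))) ⟩
    b + countAt Q? (suc j) xs + countAt Q? (j + length (x ∷ xs)) ys       ∎
    where
    open ≡-Reasoning
    b = indicator (Q? x j)

  countAt-∷-yes : ∀ j x xs → Q x j → countAt Q? j (x ∷ xs) ≡ suc (countAt Q? (suc j) xs)
  countAt-∷-yes j x xs q with Q? x j
  ... | yes _ = refl
  ... | no ¬q = ⊥-elim (¬q q)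

  countAt-∷-no : ∀ j x xs → ¬ Q x j → countAt Q? j (x ∷ xs) ≡ countAt Q? (suc j) xs
  countAt-∷-no j x xs ¬q with Q? x j
  ... | yes q = ⊥-elim (¬q q)
  ... | no  _ = refl

  countAt≤length : ∀ j xs → countAt Q? j xs ≤ length xs
  countAt≤length j []       = z≤n
  countAt≤length j (x ∷ xs) with Q? x j
  ... | yes _ = s≤s (countAt≤length (suc j) xs)
  ... | no  _ = m≤n⇒m≤1+n (countAt≤length (suc j) xs)

  countAt-replace : ∀ j A {X Y} C → length X ≡ length Y →
    countAt Q? j (A ++ X ++ C) ≤ countAt Q? j (A ++ Y ++ C) + length X
  countAt-replace j A {X} {Y} C |X|≡|Y| = begin
    countAt Q? j (A ++ X ++ C)            ≡⟨ countAt-++ j A (X ++ C) ⟩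
    a + countAt Q? i (X ++ C)             ≡⟨ cong (a +_) (countAt-++ i X C) ⟩
    a + (countAt Q? i X + countAt Q? (i + length X) C)
      ≡⟨ cong (λ n → a + (countAt Q? i X + countAt Q? (i + n) C)) |X|≡|Y| ⟩
    a + (countAt Q? i X + c)              ≤⟨ +-monoʳ-≤ a (+-monoˡ-≤ c (countAt≤length i X)) ⟩
    a + (length X + c)                    ≤⟨ +-monoʳ-≤ a (+-monoʳ-≤ (length X) (m≤n+m c (countAt Q? i Y))) ⟩
    a + (length X + (countAt Q? i Y + c)) ≡⟨ cong (a +_) (+-comm (length X) _) ⟩
    a + ((countAt Q? i Y + c) + length X) ≡⟨ sym (+-assoc a _ (length X)) ⟩
    a + (countAt Q? i Y + c) + length X   ≡⟨ cong (_+ length X) (sym (trans (countAt-++ j A (Y ++ C)) (cong (a +_) (countAt-++ i Y C)))) ⟩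
    countAt Q? j (A ++ Y ++ C) + length X ∎
    where
    open ≤-Reasoning
    a = countAt Q? j A
    i = j + length A
    c = countAt Q? (i + length Y) C

  countAt-witness : ∀ j xs → 0 < countAt Q? j xs →
    ∃ λ pre → ∃ λ x → ∃ λ post → xs ≡ pre ++ x ∷ post × Q x (j + length pre)
  countAt-witness j (x ∷ xs) 0<count with Q? x j
  ... | yes q = [] , x , xs , refl , subst (Q x) (sym (+-identityʳ j)) q
  ... | no  _ with countAt-witness (suc j) xs 0<count
  ...   | pre , y , post , refl , q = x ∷ pre , y , post , refl , subst (Q y) (sym (+-suc j (length pre))) q

  countAt-counterexample : ∀ j xs → countAt Q? j xs < length xs →
    ∃ λ pre → ∃ λ x → ∃ λ post → xs ≡ pre ++ x ∷ post × ¬ Q x (j + length pre)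
  countAt-counterexample j (x ∷ xs) count< with Q? x j
  ... | no ¬q = [] , x , xs , refl , subst (¬_ ∘ Q x) (sym (+-identityʳ j)) ¬q
  ... | yes _ with countAt-counterexample (suc j) xs (s≤s⁻¹ count<)
  ...   | pre , y , post , refl , ¬q = x ∷ pre , y , post , refl , subst (¬_ ∘ Q y) (sym (+-suc j (length pre))) ¬q

countAt-mono : ∀ {Q R : ℕ → ℕ → Set} (Q? : ∀ x j → Dec (Q x j)) (R? : ∀ x j → Dec (R x j)) →
  (∀ {x j} → Q x j → R x j) → ∀ j xs → countAt Q? j xs ≤ countAt R? j xs
countAt-mono Q? R? Q⇒R j []       = z≤n
countAt-mono Q? R? Q⇒R j (x ∷ xs) with Q? x j | R? x j
... | yes q | no ¬r = ⊥-elim (¬r (Q⇒R q))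
... | yes _ | yes _ = s≤s (countAt-mono Q? R? Q⇒R (suc j) xs)
... | no  _ | yes _ = m≤n⇒m≤1+n (countAt-mono Q? R? Q⇒R (suc j) xs)
... | no  _ | no  _ = countAt-mono Q? R? Q⇒R (suc j) xs

rearrange : List Bool → List ℕ → List ℕ
rearrange mask F = select mask F ++ select (complementMask mask) F

length-rearrange : ∀ mask F → length mask ≡ length F → length (rearrange mask F) ≡ length F
length-rearrange []           []      _    = refl
length-rearrange (true ∷ m)  (x ∷ F) |m|≡ = cong suc (length-rearrange m F (suc-injective |m|≡))
length-rearrange (false ∷ m) (x ∷ F) |m|≡ = begin
  length (select m F ++ x ∷ select (complementMask m) F)        ≡⟨ length-++ (select m F) ⟩
  length (select m F) + suc (length (select (complementMask m) F)) ≡⟨ +-suc (length (select m F)) _ ⟩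
  suc (length (select m F) + length (select (complementMask m) F)) ≡⟨ cong suc (sym (length-++ (select m F))) ⟩
  suc (length (rearrange m F))                                   ≡⟨ cong suc (length-rearrange m F (suc-injective |m|≡)) ⟩
  suc (length F)                                                 ∎
  where open ≡-Reasoning

record StepShape (K : ℕ) (π π' : List ℕ) : Set where
  field
    before fragment after : List ℕ
    mask        : List Bool
    narrow      : length fragment ≤ K
    mask-length : length mask ≡ length fragment
    source      : π ≡ before ++ fragment ++ after
    target      : π' ≡ before ++ rearrange mask fragment ++ after

length-++₃ : ∀ (A X C : List ℕ) → length (A ++ X ++ C) ≡ length A + (length X + length C)
length-++₃ A X C = trans (length-++ A) (cong (length A +_) (length-++ X))

take-length-++ : ∀ (xs ys : List ℕ) → take (length xs) (xs ++ ys) ≡ xs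
take-length-++ []       ys = refl
take-length-++ (x ∷ xs) ys = cong (x ∷_) (take-length-++ xs ys)

drop-length-++ : ∀ (xs ys : List ℕ) → drop (length xs) (xs ++ ys) ≡ ys
drop-length-++ []       ys = refl
drop-length-++ (x ∷ xs) ys = drop-length-++ xs ys

step⇒shape : ∀ {K π π'} → DLStep K π π' → StepShape K π π'
step⇒shape {K} {π} (i , k , mask , k≤K , i+k≤|π| , |mask|≡k , refl) = record
  { before      = take i π
  ; fragment    = take k (drop i π)
  ; after       = drop k (drop i π)
  ; mask        = mask
  ; narrow      = ≤-trans (≤-reflexive |F|≡k) k≤K
  ; mask-length = trans |mask|≡k (sym |F|≡k)
  ; source      = sym (trans (cong (take i π ++_) (take++drop≡id k (drop i π))) (take++drop≡id i π))
  ; target      = cong (λ C → take i π ++ rearrange mask (take k (drop i π)) ++ C) (sym (drop-drop i k π))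
  }
  where
  k≤|drop| : k ≤ length (drop i π)
  k≤|drop| = subst (k ≤_) (sym (length-drop i π)) (m+n≤o⇒m≤o∸n k (subst (_≤ length π) (+-comm i k) i+k≤|π|))
  |F|≡k : length (take k (drop i π)) ≡ k
  |F|≡k = trans (length-take k (drop i π)) (m≤n⇒m⊓n≡m k≤|drop|)

applyStep-++ : ∀ A F C mask → applyStep (length A) (length F) mask (A ++ F ++ C) ≡ A ++ rearrange mask F ++ C
applyStep-++ (x ∷ A) F C mask = cong (x ∷_) (applyStep-++ A F C mask)
applyStep-++ []      F C mask =
  cong₂ (λ F′ C′ → rearrange mask F′ ++ C′) (take-length-++ F C) (drop-length-++ F C)

shape⇒step : ∀ K A F C mask → length F ≤ K → length mask ≡ length F →
  DLStep K (A ++ F ++ C) (A ++ rearrange mask F ++ C)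
shape⇒step K A F C mask |F|≤K |mask|≡ =
  length A , length F , mask , |F|≤K , |A|+|F|≤ , |mask|≡ , sym (applyStep-++ A F C mask)
  where
  |A|+|F|≤ : length A + length F ≤ length (A ++ F ++ C)
  |A|+|F|≤ = subst (length A + length F ≤_) (sym (length-++₃ A F C))
               (+-monoʳ-≤ (length A) (m≤m+n (length F) (length C)))

length-step : ∀ {K π π'} → DLStep K π π' → length π' ≡ length π
length-step st with step⇒shape st
... | record { before = A ; fragment = F ; after = C ; mask = mask ; mask-length = |mask|≡
             ; source = refl ; target = refl } = begin
  length (A ++ rearrange mask F ++ C)              ≡⟨ length-++₃ A (rearrange mask F) C ⟩
  length A + (length (rearrange mask F) + length C) ≡⟨ cong (λ k → length A + (k + length C)) (length-rearrange mask F |mask|≡) ⟩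
  length A + (length F + length C)                 ≡⟨ sym (length-++₃ A F C) ⟩
  length (A ++ F ++ C)                             ∎
  where open ≡-Reasoning

length-steps : ∀ K p {π π'} → Steps K p π π' → length π' ≡ length π
length-steps K zero    refl                  = refl
length-steps K (suc p) (π₁ , step , steps) = trans (length-steps K p steps) (length-step step)

-- Misplaced entries

Misplaced : ℕ → ℕ → Set
Misplaced x j = x ≢ j

misplaced? : ∀ x j → Dec (Misplaced x j)
misplaced? x j = ¬? (x ≟ j)

misplaced : ℕ → List ℕ → ℕ
misplaced = countAt misplaced?

misplaced-range : ∀ a n → misplaced a (range a n) ≡ 0
misplaced-range a zero    = refl
misplaced-range a (suc n) =
  trans (countAt-∷-no misplaced? a a (range (suc a) n) (λ a≢a → a≢a refl)) (misplaced-range (suc a) n)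

misplaced-step : ∀ {K π π'} → DLStep K π π' → misplaced 0 π' ≤ misplaced 0 π + K
misplaced-step {K} st with step⇒shape st
... | record { before = A ; fragment = F ; after = C ; mask = mask ; narrow = |F|≤K
             ; mask-length = |mask|≡ ; source = refl ; target = refl } = begin
  misplaced 0 (A ++ rearrange mask F ++ C)              ≤⟨ countAt-replace misplaced? 0 A C |M|≡|F| ⟩
  misplaced 0 (A ++ F ++ C) + length (rearrange mask F) ≤⟨ +-monoʳ-≤ _ (≤-trans (≤-reflexive |M|≡|F|) |F|≤K) ⟩
  misplaced 0 (A ++ F ++ C) + K                         ∎
  where
  open ≤-Reasoning
  |M|≡|F| = length-rearrange mask F |mask|≡

misplaced-steps : ∀ K p {π π'} → Steps K p π π' → misplaced 0 π' ≤ misplaced 0 π + K * p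
misplaced-steps K zero    {π} refl = m≤m+n (misplaced 0 π) (K * 0)
misplaced-steps K (suc p) {π} {π'} (π₁ , step , steps) = begin
  misplaced 0 π'               ≤⟨ misplaced-steps K p steps ⟩
  misplaced 0 π₁ + K * p       ≤⟨ +-monoˡ-≤ (K * p) (misplaced-step step) ⟩
  misplaced 0 π + K + K * p    ≡⟨ +-assoc (misplaced 0 π) K (K * p) ⟩
  misplaced 0 π + (K + K * p)  ≡⟨ cong (misplaced 0 π +_) (sym (*-suc K p)) ⟩
  misplaced 0 π + K * suc p    ∎
  where open ≤-Reasoning

InC⇒misplaced≤ : ∀ K p σ → InC K p σ → misplaced 0 σ ≤ K * p
InC⇒misplaced≤ K p σ (n , steps) = subst (λ m → misplaced 0 σ ≤ m + K * p) misplaced-identity (misplaced-steps K p steps)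
  where
  misplaced-identity : misplaced 0 (identity n) ≡ 0
  misplaced-identity = trans (cong (misplaced 0) (upTo≡range n)) (misplaced-range 0 n)

-- Erasing an entry

-- The ℕ-analogue of Data.Fin.punchOut; punchOut w w = w is a junk value.
punchOut : ℕ → ℕ → ℕ
punchOut w v with w <? v
... | yes _ = pred v
... | no  _ = v

punchOut-≤ : ∀ {w v} → v ≤ w → punchOut w v ≡ v
punchOut-≤ {w} {v} v≤w with w <? v
... | yes w<v = ⊥-elim (<⇒≱ w<v v≤w)
... | no  _   = refl

punchOut-> : ∀ {w v} → w < v → punchOut w v ≡ pred v
punchOut-> {w} {v} w<v with w <? v
... | yes _   = refl
... | no  w≮v = ⊥-elim (w≮v w<v)

punchOut-mono-< : ∀ {w u v} → u ≢ w → u < v → punchOut w u < punchOut w v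
punchOut-mono-< {w} {u} {v} u≢w u<v with w <? u | w <? v
... | yes w<u | yes _   = pred-mono-< {{>-nonZero (≤-trans z<s w<u)}} u<v
... | yes w<u | no  w≮v = ⊥-elim (w≮v (<-trans w<u u<v))
... | no  w≮u | yes w<v = ≤-trans (≤∧≢⇒< (≮⇒≥ w≮u) u≢w) (pred-mono-≤ w<v)
... | no  _   | no  _   = u<v

punchOut-cancel-< : ∀ {w u v} → u ≢ w → v ≢ w → punchOut w u < punchOut w v → u < v
punchOut-cancel-< {w} {u} {v} u≢w v≢w pu<pv with <-cmp u v
... | tri< u<v _ _ = u<v
... | tri≈ _ refl _ = ⊥-elim (<-irrefl refl pu<pv)
... | tri> _ _ v<u = ⊥-elim (<-asym pu<pv (punchOut-mono-< v≢w v<u))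

punchOut-preimage : ∀ {w x j} → punchOut w x ≡ j → (w < x × x ≡ suc j) ⊎ (x ≤ w × x ≡ j)
punchOut-preimage {w} {x} refl with w <? x
punchOut-preimage {w} {suc x} refl | yes w<x = inj₁ (w<x , refl)
... | no w≮x = inj₂ (≮⇒≥ w≮x , refl)

map-punchOut-above : ∀ w a n → w < a → map (punchOut w) (range a n) ≡ range (pred a) n
map-punchOut-above w a       zero    w<a = refl
map-punchOut-above w (suc a) (suc n) w<a =
  cong₂ _∷_ (punchOut-> w<a) (map-punchOut-above w (suc (suc a)) n (m<n⇒m<1+n w<a))

lookup-map : ∀ (f : ℕ → ℕ) xs (eq : length xs ≡ length (map f xs)) i →
  lookup (map f xs) (cast eq i) ≡ f (lookup xs i)
lookup-map f (x ∷ xs) eq zero    = refl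
lookup-map f (x ∷ xs) eq (suc i) = lookup-map f xs (suc-injective eq) i

orderIso-map : ∀ {P : ℕ → Set} (f : ℕ → ℕ) → (∀ {u v} → P u → P v → (u < v ⇔ f u < f v)) →
  ∀ {xs} → All P xs → OrderIso xs (map f xs)
orderIso-map f f-reflects-< {xs} Pxs = eq , λ i j →
  subst₂ (λ a b → lookup xs i < lookup xs j ⇔ a < b) (sym (lookup-map f xs eq i)) (sym (lookup-map f xs eq j))
    (f-reflects-< (All.lookup Pxs (∈-lookup i)) (All.lookup Pxs (∈-lookup j)))
  where
  eq = sym (length-map f xs)

erase : List ℕ → ℕ → List ℕ → List ℕ
erase pre w post = map (punchOut w) (pre ++ post)

length-erase : ∀ pre w post → length (erase pre w post) < length (pre ++ w ∷ post)
length-erase pre w post = begin-strict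
  length (map (punchOut w) (pre ++ post)) ≡⟨ length-map (punchOut w) (pre ++ post) ⟩
  length (pre ++ post)                    ≡⟨ length-++ pre ⟩
  length pre + length post                <⟨ +-monoʳ-< (length pre) (n<1+n (length post)) ⟩
  length pre + length (w ∷ post)          ≡⟨ sym (length-++ pre) ⟩
  length (pre ++ w ∷ post)                ∎
  where open ≤-Reasoning

erase-isPattern : ∀ pre w post → All (_≢ w) (pre ++ post) → IsPattern (erase pre w post) (pre ++ w ∷ post)
erase-isPattern pre w post ≢w = pre ++ post , Sublist.++⁺ ⊆-refl (w ∷ʳ ⊆-refl) ,
  orderIso-map (punchOut w) (λ u≢w v≢w → mk⇔ (punchOut-mono-< u≢w) (punchOut-cancel-< u≢w v≢w)) ≢w

erase-isPerm : ∀ pre w post → IsPerm (pre ++ w ∷ post) →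
  All (_≢ w) (pre ++ post) × IsPerm (erase pre w post)
erase-isPerm pre w post σ↭ = ≢w , τ↭
  where
  n = length (pre ++ w ∷ post)
  σ↭range : pre ++ w ∷ post ↭ range 0 n
  σ↭range = subst (pre ++ w ∷ post ↭_) (upTo≡range n) σ↭
  w<n : w < n
  w<n = proj₂ (∈-range⁻ 0 n (∈-resp-↭ σ↭range (∈-++⁺ʳ pre (here refl))))
  k = n ∸ suc w
  rest↭ : pre ++ post ↭ range 0 w ++ range (suc w) k
  rest↭ = drop-mid pre (range 0 w) (subst (pre ++ w ∷ post ↭_) (range-around 0 w<n) σ↭range)
  ≢w : All (_≢ w) (pre ++ post)
  ≢w = All-resp-↭ (↭-sym rest↭)
         (Allₚ.++⁺ (All-range⁺ 0 w (λ _ x<w → <⇒≢ x<w)) (All-range⁺ (suc w) k (λ w<x _ → >⇒≢ w<x)))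
  punched : map (punchOut w) (range 0 w ++ range (suc w) k) ≡ range 0 (w + k)
  punched = begin
    map (punchOut w) (range 0 w ++ range (suc w) k)                 ≡⟨ map-++ (punchOut w) (range 0 w) _ ⟩
    map (punchOut w) (range 0 w) ++ map (punchOut w) (range (suc w) k)
      ≡⟨ cong₂ _++_ (map-id-local (All-range⁺ 0 w (λ _ x<w → punchOut-≤ (<⇒≤ x<w))))
                    (map-punchOut-above w (suc w) k ≤-refl) ⟩
    range 0 w ++ range w k                                          ≡⟨ sym (range-++ 0 w k) ⟩
    range 0 (w + k)                                                 ∎
    where open ≡-Reasoning
  τ↭range : erase pre w post ↭ range 0 (w + k)
  τ↭range = subst (erase pre w post ↭_) punched (↭.map⁺ (punchOut w) rest↭)
  τ↭ : IsPerm (erase pre w post)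
  τ↭ = subst (erase pre w post ↭_)
         (trans (sym (upTo≡range (w + k))) (cong upTo (sym (trans (↭-length τ↭range) (length-range 0 (w + k))))))
         τ↭range

JustAbove : ℕ → ℕ → ℕ → Set
JustAbove w x j = w < x × x ≡ suc j

justAbove? : ∀ w x j → Dec (JustAbove w x j)
justAbove? w x j = (w <? x) ×-dec (x ≟ suc j)

JustBelow : ℕ → ℕ → ℕ → Set
JustBelow w x j = x < w × suc x ≡ j

justBelow? : ∀ w x j → Dec (JustBelow w x j)
justBelow? w x j = (x <? w) ×-dec (suc x ≟ j)

misplaced-before : ∀ w j xs →
  misplaced j xs ≤ misplaced j (map (punchOut w) xs) + countAt (justAbove? w) j xs
misplaced-before w j []       = z≤n
misplaced-before w j (x ∷ xs) = begin
  indicator (misplaced? x j) + misplaced (suc j) xs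
    ≤⟨ +-mono-≤ (indicator-≤-+ (misplaced? x j) (misplaced? (punchOut w x) j) (justAbove? w x j) becomesFixed)
                (misplaced-before w (suc j) xs) ⟩
  (a + b) + (c + d) ≡⟨ interchange a b c d ⟩
  (a + c) + (b + d) ∎
  where
  open ≤-Reasoning
  a = indicator (misplaced? (punchOut w x) j)
  b = indicator (justAbove? w x j)
  c = misplaced (suc j) (map (punchOut w) xs)
  d = countAt (justAbove? w) (suc j) xs
  becomesFixed : Misplaced x j → ¬ Misplaced (punchOut w x) j → JustAbove w x j
  becomesFixed x≢j fixed with punchOut-preimage (decidable-stable (punchOut w x ≟ j) fixed)
  ... | inj₁ above       = above
  ... | inj₂ (_ , x≡j)   = ⊥-elim (x≢j x≡j)

misplaced-after : ∀ w j xs → All (_≢ w) xs →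
  misplaced (suc j) xs ≤ misplaced j (map (punchOut w) xs) + countAt (justBelow? w) (suc j) xs
misplaced-after w j []       []           = z≤n
misplaced-after w j (x ∷ xs) (x≢w ∷ ≢w) = begin
  indicator (misplaced? x (suc j)) + misplaced (suc (suc j)) xs
    ≤⟨ +-mono-≤ (indicator-≤-+ (misplaced? x (suc j)) (misplaced? (punchOut w x) j) (justBelow? w x (suc j)) becomesFixed)
                (misplaced-after w (suc j) xs ≢w) ⟩
  (a + b) + (c + d) ≡⟨ interchange a b c d ⟩
  (a + c) + (b + d) ∎
  where
  open ≤-Reasoning
  a = indicator (misplaced? (punchOut w x) j)
  b = indicator (justBelow? w x (suc j))
  c = misplaced (suc j) (map (punchOut w) xs)
  d = countAt (justBelow? w) (suc (suc j)) xs
  becomesFixed : Misplaced x (suc j) → ¬ Misplaced (punchOut w x) j → JustBelow w x (suc j)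
  becomesFixed x≢1+j fixed with punchOut-preimage (decidable-stable (punchOut w x ≟ j) fixed)
  ... | inj₁ (_ , x≡1+j) = ⊥-elim (x≢1+j x≡1+j)
  ... | inj₂ (x≤w , x≡j) = ≤∧≢⇒< x≤w x≢w , cong suc x≡j

-- Erasing w makes an entry fixed only if it sits one off the diagonal, on the
-- side towards which the erasure shifts it.
erasureLoss : List ℕ → ℕ → List ℕ → ℕ
erasureLoss pre w post =
  indicator (misplaced? w (length pre)) + countAt (justAbove? w) 0 pre + countAt (justBelow? w) (suc (length pre)) post

misplaced-erase : ∀ pre w post → All (_≢ w) post →
  misplaced 0 (pre ++ w ∷ post) ≤ misplaced 0 (erase pre w post) + erasureLoss pre w post
misplaced-erase pre w post ≢w = begin
  misplaced 0 (pre ++ w ∷ post)               ≡⟨ countAt-++ misplaced? 0 pre (w ∷ post) ⟩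
  misplaced 0 pre + (i + misplaced (suc a) post)
    ≤⟨ +-mono-≤ (misplaced-before w 0 pre) (+-monoʳ-≤ i (misplaced-after w a post ≢w)) ⟩
  (x + u) + (i + (y + d))                     ≡⟨ regroup x u i y d ⟩
  (x + y) + (i + u + d)                       ≡⟨ cong (_+ (i + u + d)) (sym misplaced-τ) ⟩
  misplaced 0 (erase pre w post) + erasureLoss pre w post ∎
  where
  open ≤-Reasoning
  a = length pre
  i = indicator (misplaced? w a)
  x = misplaced 0 (map (punchOut w) pre)
  y = misplaced a (map (punchOut w) post)
  u = countAt (justAbove? w) 0 pre
  d = countAt (justBelow? w) (suc a) post
  misplaced-τ : misplaced 0 (erase pre w post) ≡ x + y
  misplaced-τ = begin-equality
    misplaced 0 (map (punchOut w) (pre ++ post))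
      ≡⟨ cong (misplaced 0) (map-++ (punchOut w) pre post) ⟩
    misplaced 0 (map (punchOut w) pre ++ map (punchOut w) post)
      ≡⟨ countAt-++ misplaced? 0 (map (punchOut w) pre) _ ⟩
    x + misplaced (length (map (punchOut w) pre)) (map (punchOut w) post)
      ≡⟨ cong (λ k → x + misplaced k (map (punchOut w) post)) (length-map (punchOut w) pre) ⟩
    x + y ∎
  regroup : ∀ x u i y d → (x + u) + (i + (y + d)) ≡ (x + y) + (i + u + d)
  regroup = solve-∀

justAbove-count≤ : ∀ w j xs → countAt (justAbove? w) j xs ≤ (j + length xs) ∸ w
justAbove-count≤ w j xs with w ≤? j
... | yes w≤j = begin
  countAt (justAbove? w) j xs ≤⟨ countAt≤length (justAbove? w) j xs ⟩
  length xs                   ≤⟨ m≤n+m (length xs) (j ∸ w) ⟩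
  j ∸ w + length xs           ≡⟨ sym (+-∸-comm (length xs) w≤j) ⟩
  (j + length xs) ∸ w         ∎
  where open ≤-Reasoning
justAbove-count≤ w j []       | no _   = z≤n
justAbove-count≤ w j (x ∷ xs) | no w≰j = begin
  countAt (justAbove? w) j (x ∷ xs) ≡⟨ countAt-∷-no (justAbove? w) j x xs (λ { (w<x , refl) → w≰j (s≤s⁻¹ w<x) }) ⟩
  countAt (justAbove? w) (suc j) xs ≤⟨ justAbove-count≤ w (suc j) xs ⟩
  (suc j + length xs) ∸ w           ≡⟨ cong (_∸ w) (sym (+-suc j (length xs))) ⟩
  (j + length (x ∷ xs)) ∸ w         ∎
  where open ≤-Reasoning

justBelow-count≤ : ∀ w j xs → countAt (justBelow? w) j xs ≤ suc w ∸ j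
justBelow-count≤ w j []       = z≤n
justBelow-count≤ w j (x ∷ xs) with justBelow? w x j
... | yes below@(x<w , refl) = begin
  countAt (justBelow? w) (suc x) (x ∷ xs) ≡⟨ countAt-∷-yes (justBelow? w) (suc x) x xs below ⟩
  suc (countAt (justBelow? w) (2+ x) xs)  ≤⟨ s≤s (justBelow-count≤ w (2+ x) xs) ⟩
  suc (suc w ∸ 2+ x)                      ≡⟨ sym (+-∸-assoc 1 x<w) ⟩
  suc w ∸ suc x                           ∎
  where open ≤-Reasoning
... | no ¬below = begin
  countAt (justBelow? w) j (x ∷ xs) ≡⟨ countAt-∷-no (justBelow? w) j x xs ¬below ⟩
  countAt (justBelow? w) (suc j) xs ≤⟨ justBelow-count≤ w (suc j) xs ⟩
  suc w ∸ suc j                     ≤⟨ ∸-monoʳ-≤ (suc w) (n≤1+n j) ⟩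
  suc w ∸ j                         ∎
  where open ≤-Reasoning

StrictPatternOutside : ℕ → ℕ → List ℕ → Set
StrictPatternOutside K p σ = ∃ λ τ → IsPerm τ × IsPattern τ σ × length τ < length σ × ¬ InC K p τ

erase-outside : ∀ K p pre w post c → IsPerm (pre ++ w ∷ post) → erasureLoss pre w post ≤ c →
  K * p + c < misplaced 0 (pre ++ w ∷ post) → StrictPatternOutside K p (pre ++ w ∷ post)
erase-outside K p pre w post c σ-perm loss≤c Kp+c<mis =
  erase pre w post , τ-perm , erase-isPattern pre w post ≢w , length-erase pre w post , τ∉C
  where
  open ≤-Reasoning
  ≢w = proj₁ (erase-isPerm pre w post σ-perm)
  τ-perm = proj₂ (erase-isPerm pre w post σ-perm)
  τ∉C : ¬ InC K p (erase pre w post)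
  τ∉C τ∈C = <⇒≱ Kp+c<mis (begin
    misplaced 0 (pre ++ w ∷ post)                          ≤⟨ misplaced-erase pre w post (Allₚ.++⁻ʳ pre ≢w) ⟩
    misplaced 0 (erase pre w post) + erasureLoss pre w post ≤⟨ +-mono-≤ (InC⇒misplaced≤ K p _ τ∈C) loss≤c ⟩
    K * p + c                                              ∎)

-- Many misplaced entries

AboveDiagonal : ℕ → ℕ → Set
AboveDiagonal x j = x ≡ suc j

aboveDiagonal? : ∀ x j → Dec (AboveDiagonal x j)
aboveDiagonal? x j = x ≟ suc j

0∈perm : ∀ σ → IsPerm σ → 0 < length σ → 0 ∈ σ
0∈perm (x ∷ σ) σ↭ _ = ∈-resp-↭ (↭-sym σ↭) (here refl)

erasureLoss-fixed : ∀ pre post → erasureLoss pre (length pre) post ≤ 0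
erasureLoss-fixed pre post =
  +-mono-≤ (+-mono-≤ (≤-reflexive (indicator-no (misplaced? a a) (λ a≢a → a≢a refl)))
                     (≤-trans (justAbove-count≤ a 0 pre) (≤-reflexive (n∸n≡0 a))))
           (≤-trans (justBelow-count≤ a (suc a) post) (≤-reflexive (n∸n≡0 a)))
  where a = length pre

erasureLoss-aboveDiagonal : ∀ pre post → erasureLoss pre (suc (length pre)) post ≤ 2
erasureLoss-aboveDiagonal pre post =
  +-mono-≤ (+-mono-≤ (indicator≤1 (misplaced? (suc a) a))
                     (≤-trans (justAbove-count≤ (suc a) 0 pre) (≤-reflexive (m≤n⇒m∸n≡0 (n≤1+n a)))))
           (≤-trans (justBelow-count≤ (suc a) (suc a) post) (≤-reflexive (m+n∸n≡m 1 (suc a))))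
  where a = length pre

erasureLoss-zero : ∀ pre post → countAt aboveDiagonal? 0 pre ≤ 0 → erasureLoss pre 0 post ≤ 1
erasureLoss-zero pre post noneAbove =
  +-mono-≤ (+-mono-≤ (indicator≤1 (misplaced? 0 (length pre)))
                     (≤-trans (countAt-mono (justAbove? 0) aboveDiagonal? proj₂ 0 pre) noneAbove))
           (≤-trans (justBelow-count≤ 0 (suc (length pre)) post) (≤-reflexive (0∸n≡0 (length pre))))

outside-viaFixedPoint : ∀ K p σ → IsPerm σ → K * p < misplaced 0 σ → misplaced 0 σ < length σ →
  StrictPatternOutside K p σ
outside-viaFixedPoint K p σ σ-perm Kp<mis hasFixed with countAt-counterexample misplaced? 0 σ hasFixed
... | pre , x , post , refl , fixed with decidable-stable (x ≟ length pre) fixed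
...   | refl = erase-outside K p pre x post 0 σ-perm (erasureLoss-fixed pre post)
                 (subst (_< misplaced 0 σ) (sym (+-identityʳ (K * p))) Kp<mis)

outside-viaNearDiagonal : ∀ K p σ → IsPerm σ → K * p + 2 < misplaced 0 σ → StrictPatternOutside K p σ
outside-viaNearDiagonal K p σ σ-perm Kp+2<mis with 0 <? countAt aboveDiagonal? 0 σ
... | yes someAbove with countAt-witness aboveDiagonal? 0 σ someAbove
...   | pre , x , post , refl , refl =
  erase-outside K p pre x post 2 σ-perm (erasureLoss-aboveDiagonal pre post) Kp+2<mis
outside-viaNearDiagonal K p σ σ-perm Kp+2<mis | no noneAbove
  with ∈-∃++ (0∈perm σ σ-perm (≤-trans (s≤s z≤n) (≤-trans Kp+2<mis (countAt≤length misplaced? 0 σ))))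
... | pre , post , refl =
  erase-outside K p pre 0 post 1 σ-perm (erasureLoss-zero pre post noneAbove-pre)
    (≤-<-trans (+-monoʳ-≤ (K * p) (n≤1+n 1)) Kp+2<mis)
  where
  noneAbove-pre : countAt aboveDiagonal? 0 pre ≤ 0
  noneAbove-pre = ≤-trans (≤-trans (m≤m+n _ _) (≤-reflexive (sym (countAt-++ aboveDiagonal? 0 pre (0 ∷ post)))))
                          (≮⇒≥ noneAbove)

manyMisplaced-outside : ∀ K p σ → IsPerm σ → K * p < misplaced 0 σ → K * p + 3 ≤ length σ →
  StrictPatternOutside K p σ
manyMisplaced-outside K p σ σ-perm Kp<mis Kp+3≤n with misplaced 0 σ <? length σ
... | yes hasFixed = outside-viaFixedPoint K p σ σ-perm Kp<mis hasFixed
... | no  noFixed  = outside-viaNearDiagonal K p σ σ-perm (begin-strict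
  K * p + 2        <⟨ subst (_≤ length σ) (+-suc (K * p) 2) Kp+3≤n ⟩
  length σ         ≤⟨ ≮⇒≥ noFixed ⟩
  misplaced 0 σ    ∎)
  where open ≤-Reasoning

-- Inserting a fixed point

punchIn : ℕ → ℕ → ℕ
punchIn s v with v <? s
... | yes _ = v
... | no  _ = suc v

punchIn-< : ∀ {s v} → v < s → punchIn s v ≡ v
punchIn-< {s} {v} v<s with v <? s
... | yes _   = refl
... | no  v≮s = ⊥-elim (v≮s v<s)

punchIn-≥ : ∀ {s v} → s ≤ v → punchIn s v ≡ suc v
punchIn-≥ {s} {v} s≤v with v <? s
... | yes v<s = ⊥-elim (<⇒≱ v<s s≤v)
... | no  _   = refl

punchIn-punchOut : ∀ {a v} → v ≢ a → punchIn a (punchOut a v) ≡ v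
punchIn-punchOut {a} {v} v≢a with a <? v
punchIn-punchOut {a} {suc v} v≢a | yes a<1+v = punchIn-≥ (s≤s⁻¹ a<1+v)
... | no a≮v = punchIn-< (≤∧≢⇒< (≮⇒≥ a≮v) v≢a)

punchIn-suc : ∀ {s v} → v ≢ s → punchIn s v ≡ punchIn (suc s) v
punchIn-suc {s} {v} v≢s with <-cmp v s
... | tri< v<s _ _  = trans (punchIn-< v<s) (sym (punchIn-< (m<n⇒m<1+n v<s)))
... | tri≈ _ v≡s _ = ⊥-elim (v≢s v≡s)
... | tri> _ _ s<v  = trans (punchIn-≥ (<⇒≤ s<v)) (sym (punchIn-≥ s<v))

map-punchIn-above : ∀ s a n → s ≤ a → map (punchIn s) (range a n) ≡ range (suc a) n
map-punchIn-above s a zero    s≤a = refl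
map-punchIn-above s a (suc n) s≤a = cong₂ _∷_ (punchIn-≥ s≤a) (map-punchIn-above s (suc a) n (m≤n⇒m≤1+n s≤a))

insertAtIndex : ℕ → ℕ → List ℕ → List ℕ
insertAtIndex i v xs = take i xs ++ v ∷ drop i xs

insertAtIndex-++ʳ : ∀ (X Y : List ℕ) t v → insertAtIndex (length X + t) v (X ++ Y) ≡ X ++ insertAtIndex t v Y
insertAtIndex-++ʳ []      Y t v = refl
insertAtIndex-++ʳ (x ∷ X) Y t v = cong (x ∷_) (insertAtIndex-++ʳ X Y t v)

insertAtIndex-length : ∀ (X Y : List ℕ) v → insertAtIndex (length X) v (X ++ Y) ≡ X ++ v ∷ Y
insertAtIndex-length []      Y v = refl
insertAtIndex-length (x ∷ X) Y v = cong (x ∷_) (insertAtIndex-length X Y v)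

insertAtIndex-++ˡ : ∀ (X Y : List ℕ) s v → s ≤ length X → insertAtIndex s v (X ++ Y) ≡ insertAtIndex s v X ++ Y
insertAtIndex-++ˡ X       Y zero    v _           = refl
insertAtIndex-++ˡ (x ∷ X) Y (suc s) v (s≤s s≤|X|) = cong (x ∷_) (insertAtIndex-++ˡ X Y s v s≤|X|)

insertFixedPoint : ℕ → List ℕ → List ℕ
insertFixedPoint s π = insertAtIndex s s (map (punchIn s) π)

insertFixedPoint-range : ∀ {s n} → s ≤ n → insertFixedPoint s (range 0 n) ≡ range 0 (suc n)
insertFixedPoint-range {s} {n} s≤n = begin
  insertAtIndex s s (map (punchIn s) (range 0 n))
    ≡⟨ cong (insertAtIndex s s ∘ map (punchIn s)) (range-split 0 s≤n) ⟩
  insertAtIndex s s (map (punchIn s) (range 0 s ++ range s k))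
    ≡⟨ cong (insertAtIndex s s) (map-++ (punchIn s) (range 0 s) (range s k)) ⟩
  insertAtIndex s s (map (punchIn s) (range 0 s) ++ map (punchIn s) (range s k))
    ≡⟨ cong₂ (λ X Y → insertAtIndex s s (X ++ Y))
         (map-id-local (All-range⁺ 0 s (λ _ x<s → punchIn-< x<s))) (map-punchIn-above s s k ≤-refl) ⟩
  insertAtIndex s s (range 0 s ++ range (suc s) k)
    ≡⟨ cong (λ i → insertAtIndex i s (range 0 s ++ range (suc s) k)) (sym (length-range 0 s)) ⟩
  insertAtIndex (length (range 0 s)) s (range 0 s ++ range (suc s) k)
    ≡⟨ insertAtIndex-length (range 0 s) (range (suc s) k) s ⟩
  range 0 s ++ range s (suc k)   ≡⟨ sym (range-++ 0 s (suc k)) ⟩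
  range 0 (s + suc k)            ≡⟨ cong (range 0) (trans (+-suc s k) (cong suc (m+[n∸m]≡n s≤n))) ⟩
  range 0 (suc n)                ∎
  where
  open ≡-Reasoning
  k = n ∸ s

insertFixedPoint-suc : ∀ Y Z s → length Y ≡ s → All (_≢ s) (Y ++ Z) →
  insertFixedPoint s (Y ++ s ∷ Z) ≡ insertFixedPoint (suc s) (Y ++ s ∷ Z)
insertFixedPoint-suc Y Z s |Y|≡s ≢s = begin
  insertAtIndex s s (map (punchIn s) (Y ++ s ∷ Z))
    ≡⟨ cong (insertAtIndex s s) (map-++ (punchIn s) Y (s ∷ Z)) ⟩
  insertAtIndex s s (bY ++ punchIn s s ∷ bZ)
    ≡⟨ cong (λ i → insertAtIndex i s (bY ++ punchIn s s ∷ bZ)) (sym |bY|≡s) ⟩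
  insertAtIndex (length bY) s (bY ++ punchIn s s ∷ bZ)
    ≡⟨ insertAtIndex-length bY (punchIn s s ∷ bZ) s ⟩
  bY ++ s ∷ punchIn s s ∷ bZ
    ≡⟨ cong₂ (λ X W → X ++ s ∷ W) bY≡b′Y (cong₂ _∷_ (punchIn-≥ ≤-refl) bZ≡b′Z) ⟩
  b′Y ++ s ∷ suc s ∷ b′Z
    ≡⟨ cong (λ v → b′Y ++ v ∷ suc s ∷ b′Z) (sym (punchIn-< ≤-refl)) ⟩
  b′Y ++ insertAtIndex 1 (suc s) (punchIn (suc s) s ∷ b′Z)
    ≡⟨ sym (insertAtIndex-++ʳ b′Y (punchIn (suc s) s ∷ b′Z) 1 (suc s)) ⟩
  insertAtIndex (length b′Y + 1) (suc s) (b′Y ++ punchIn (suc s) s ∷ b′Z)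
    ≡⟨ cong (λ i → insertAtIndex i (suc s) (b′Y ++ punchIn (suc s) s ∷ b′Z)) |b′Y|+1≡1+s ⟩
  insertAtIndex (suc s) (suc s) (b′Y ++ punchIn (suc s) s ∷ b′Z)
    ≡⟨ cong (insertAtIndex (suc s) (suc s)) (sym (map-++ (punchIn (suc s)) Y (s ∷ Z))) ⟩
  insertAtIndex (suc s) (suc s) (map (punchIn (suc s)) (Y ++ s ∷ Z)) ∎
  where
  open ≡-Reasoning
  bY  = map (punchIn s) Y
  bZ  = map (punchIn s) Z
  b′Y = map (punchIn (suc s)) Y
  b′Z = map (punchIn (suc s)) Z
  |bY|≡s : length bY ≡ s
  |bY|≡s = trans (length-map (punchIn s) Y) |Y|≡s
  |b′Y|+1≡1+s : length b′Y + 1 ≡ suc s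
  |b′Y|+1≡1+s = trans (+-comm _ 1) (cong suc (trans (length-map (punchIn (suc s)) Y) |Y|≡s))
  bY≡b′Y : bY ≡ b′Y
  bY≡b′Y = map-cong-local (All.map punchIn-suc (Allₚ.++⁻ˡ Y ≢s))
  bZ≡b′Z : bZ ≡ b′Z
  bZ≡b′Z = map-cong-local (All.map punchIn-suc (Allₚ.++⁻ʳ Y ≢s))

insertFixedPoint-erase : ∀ pre post → All (_≢ length pre) (pre ++ post) →
  insertFixedPoint (length pre) (erase pre (length pre) post) ≡ pre ++ length pre ∷ post
insertFixedPoint-erase pre post ≢a = begin
  insertAtIndex a a (map (punchIn a) (map (punchOut a) (pre ++ post))) ≡⟨ cong (insertAtIndex a a) (sym (map-∘ (pre ++ post))) ⟩
  insertAtIndex a a (map (punchIn a ∘ punchOut a) (pre ++ post))        ≡⟨ cong (insertAtIndex a a) (map-id-local (All.map punchIn-punchOut ≢a)) ⟩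
  insertAtIndex a a (pre ++ post)                                       ≡⟨ insertAtIndex-length pre post a ⟩
  pre ++ a ∷ post                                                       ∎
  where
  open ≡-Reasoning
  a = length pre

insertFixedPoint-alongRun : ∀ X W a m → length X ≡ a → IsPerm (X ++ range a m ++ W) → ∀ t → t ≤ m →
  insertFixedPoint (a + t) (X ++ range a m ++ W) ≡ insertFixedPoint a (X ++ range a m ++ W)
insertFixedPoint-alongRun X W a m |X| τ-perm zero    _     = cong (λ s → insertFixedPoint s (X ++ range a m ++ W)) (+-identityʳ a)
insertFixedPoint-alongRun X W a m |X| τ-perm (suc t) 1+t≤m = begin
  insertFixedPoint (a + suc t) τ              ≡⟨ cong (λ s → insertFixedPoint s τ) (+-suc a t) ⟩
  insertFixedPoint (suc (a + t)) τ            ≡⟨ cong (insertFixedPoint (suc (a + t))) τ≡Y++t∷Z ⟩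
  insertFixedPoint (suc (a + t)) (Y ++ (a + t) ∷ Z)
    ≡⟨ sym (insertFixedPoint-suc Y Z (a + t) |Y| (proj₁ (erase-isPerm Y (a + t) Z (subst IsPerm τ≡Y++t∷Z τ-perm)))) ⟩
  insertFixedPoint (a + t) (Y ++ (a + t) ∷ Z) ≡⟨ cong (insertFixedPoint (a + t)) (sym τ≡Y++t∷Z) ⟩
  insertFixedPoint (a + t) τ                  ≡⟨ insertFixedPoint-alongRun X W a m |X| τ-perm t (<⇒≤ 1+t≤m) ⟩
  insertFixedPoint a τ                        ∎
  where
  open ≡-Reasoning
  τ = X ++ range a m ++ W
  Y = X ++ range a t
  Z = range (suc (a + t)) (m ∸ suc t) ++ W
  |Y| : length Y ≡ a + t
  |Y| = trans (length-++ X) (cong₂ _+_ |X| (length-range a t))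
  τ≡Y++t∷Z : τ ≡ Y ++ (a + t) ∷ Z
  τ≡Y++t∷Z = begin
    X ++ range a m ++ W                                                ≡⟨ cong (λ R → X ++ R ++ W) (range-around a 1+t≤m) ⟩
    X ++ (range a t ++ (a + t) ∷ range (suc (a + t)) (m ∸ suc t)) ++ W ≡⟨ cong (X ++_) (++-assoc (range a t) _ W) ⟩
    X ++ range a t ++ (a + t) ∷ Z                                      ≡⟨ sym (++-assoc X (range a t) _) ⟩
    Y ++ (a + t) ∷ Z                                                   ∎

map-select : ∀ (f : ℕ → ℕ) mask F → map f (select mask F) ≡ select mask (map f F)
map-select f []           F       = refl
map-select f (b ∷ mask)   []      = refl
map-select f (true ∷ m)  (x ∷ F) = cong (f x ∷_) (map-select f m F)
map-select f (false ∷ m) (x ∷ F) = map-select f m F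

map-rearrange : ∀ (f : ℕ → ℕ) mask F → map f (rearrange mask F) ≡ rearrange mask (map f F)
map-rearrange f mask F = trans (map-++ f (select mask F) _)
  (cong₂ _++_ (map-select f mask F) (map-select f (complementMask mask) F))

module _ (s : ℕ) (A X C : List ℕ) where

  private
    b = map (punchIn s)

    b-++₃ : b (A ++ X ++ C) ≡ b A ++ b X ++ b C
    b-++₃ = trans (map-++ (punchIn s) A (X ++ C)) (cong (b A ++_) (map-++ (punchIn s) X C))

  insertFixedPoint-++-left : s ≤ length A → insertFixedPoint s (A ++ X ++ C) ≡
    insertAtIndex s s (map (punchIn s) A) ++ map (punchIn s) X ++ map (punchIn s) C
  insertFixedPoint-++-left s≤|A| = trans (cong (insertAtIndex s s) b-++₃)
    (insertAtIndex-++ˡ (b A) (b X ++ b C) s s (subst (s ≤_) (sym (length-map (punchIn s) A)) s≤|A|))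

  insertFixedPoint-++-right : ∀ t → length A + length X + t ≡ s → insertFixedPoint s (A ++ X ++ C) ≡
    map (punchIn s) A ++ map (punchIn s) X ++ insertAtIndex t s (map (punchIn s) C)
  insertFixedPoint-++-right t |A|+|X|+t≡s = begin
    insertAtIndex s s (b (A ++ X ++ C))                     ≡⟨ cong (insertAtIndex s s) (trans b-++₃ (sym (++-assoc (b A) (b X) (b C)))) ⟩
    insertAtIndex s s ((b A ++ b X) ++ b C)                 ≡⟨ cong (λ i → insertAtIndex i s ((b A ++ b X) ++ b C)) (sym s≡) ⟩
    insertAtIndex (length (b A ++ b X) + t) s ((b A ++ b X) ++ b C) ≡⟨ insertAtIndex-++ʳ (b A ++ b X) (b C) t s ⟩
    (b A ++ b X) ++ insertAtIndex t s (b C)                 ≡⟨ ++-assoc (b A) (b X) _ ⟩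
    b A ++ b X ++ insertAtIndex t s (b C)                   ∎
    where
    open ≡-Reasoning
    s≡ : length (b A ++ b X) + t ≡ s
    s≡ = trans (cong (_+ t) (trans (length-++ (b A)) (cong₂ _+_ (length-map (punchIn s) A) (length-map (punchIn s) X))))
               |A|+|X|+t≡s

OutsideWindow : ℕ → ℕ → ℕ → Set
OutsideWindow i k s = s ≤ i ⊎ i + k ≤ s

outsideWindow? : ∀ i k s → Dec (OutsideWindow i k s)
outsideWindow? i k s = (s ≤? i) ⊎-dec (i + k ≤? s)

¬outside⇒inside : ∀ {i k s} → ¬ OutsideWindow i k s → i ≤ s × s < i + k
¬outside⇒inside ¬out = <⇒≤ (≰⇒> (¬out ∘ inj₁)) , ≰⇒> (¬out ∘ inj₂)

module _ (K : ℕ) (A F C : List ℕ) (mask : List Bool) (|F|≤K : length F ≤ K) (|mask|≡ : length mask ≡ length F) (s : ℕ) where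

  private
    b = map (punchIn s)
    M = rearrange mask F
    |bF|≤K = subst (_≤ K) (sym (length-map (punchIn s) F)) |F|≤K
    |mask|≡|bF| = trans |mask|≡ (sym (length-map (punchIn s) F))

  insertFixedPoint-step : OutsideWindow (length A) (length F) s →
    DLStep K (insertFixedPoint s (A ++ F ++ C)) (insertFixedPoint s (A ++ rearrange mask F ++ C))
  insertFixedPoint-step (inj₁ s≤|A|) =
    subst₂ (DLStep K) (sym (insertFixedPoint-++-left s A F C s≤|A|))
      (sym (trans (insertFixedPoint-++-left s A M C s≤|A|)
                  (cong (λ Y → insertAtIndex s s (b A) ++ Y ++ b C) (map-rearrange (punchIn s) mask F))))
      (shape⇒step K (insertAtIndex s s (b A)) (b F) (b C) mask |bF|≤K |mask|≡|bF|)
  insertFixedPoint-step (inj₂ |A|+|F|≤s) =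
    subst₂ (DLStep K) (sym (insertFixedPoint-++-right s A F C t (m+[n∸m]≡n |A|+|F|≤s)))
      (sym (trans (insertFixedPoint-++-right s A M C t |A|+|M|+t≡s)
                  (cong (λ Y → b A ++ Y ++ insertAtIndex t s (b C)) (map-rearrange (punchIn s) mask F))))
      (shape⇒step K (b A) (b F) (insertAtIndex t s (b C)) mask |bF|≤K |mask|≡|bF|)
    where
    t = s ∸ (length A + length F)
    |A|+|M|+t≡s = trans (cong (λ m → length A + m + t) (length-rearrange mask F |mask|≡)) (m+[n∸m]≡n |A|+|F|≤s)

length-filter+filter¬ : ∀ {P : ℕ → Set} (P? : ∀ x → Dec (P x)) xs →
  length (filter P? xs) + length (filter (¬? ∘ P?) xs) ≡ length xs
length-filter+filter¬ P? []       = refl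
length-filter+filter¬ P? (x ∷ xs) with P? x
... | yes _ = cong suc (length-filter+filter¬ P? xs)
... | no  _ = trans (+-suc _ _) (cong suc (length-filter+filter¬ P? xs))

sorted-length≤ : ∀ {a c} T → AllPairs _<_ T → All (λ x → a ≤ x × x < c) T → length T ≤ c ∸ a
sorted-length≤ {a} {c} []      []               []                   = z≤n
sorted-length≤ {a} {c} (x ∷ T) (x<T ∷ T-sorted) ((a≤x , x<c) ∷ T-in) = begin
  suc (length T)   ≤⟨ s≤s (sorted-length≤ T T-sorted (All.zipWith (λ (x<y , _ , y<c) → x<y , y<c) (x<T , T-in))) ⟩
  suc (c ∸ suc x)  ≡⟨ sym (+-∸-assoc 1 x<c) ⟩
  c ∸ x            ≤⟨ ∸-monoʳ-≤ c a≤x ⟩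
  c ∸ a            ∎
  where open ≤-Reasoning

-- A step with window [i, i + k) only disturbs the insertion points strictly
-- inside it, at most K of them, so more than K p candidates leave a survivor.
Steps-insertFixedPoint : ∀ K p {π π'} → Steps K p π π' → (S : List ℕ) → AllPairs _<_ S → K * p < length S →
  ∃ λ s → s ∈ S × Steps K p (insertFixedPoint s π) (insertFixedPoint s π')
Steps-insertFixedPoint K zero refl []      _ Kp<0 = ⊥-elim (n≮0 Kp<0)
Steps-insertFixedPoint K zero refl (s ∷ S) _ _    = s , here refl , refl
Steps-insertFixedPoint K (suc p) (π₁ , step , steps) S S-sorted K[1+p]<|S| with step⇒shape step
... | record { before = A ; fragment = F ; after = C ; mask = mask ; narrow = |F|≤K
             ; mask-length = |mask|≡ ; source = refl ; target = refl }
  with Steps-insertFixedPoint K p steps (filter outside? S) (AllPairs.filter⁺ outside? S-sorted) Kp<|S′|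
  where
  outside? = outsideWindow? (length A) (length F)
  T = filter (¬? ∘ outside?) S
  |T|≤K : length T ≤ K
  |T|≤K = begin
    length T                            ≤⟨ sorted-length≤ T (AllPairs.filter⁺ (¬? ∘ outside?) S-sorted)
                                             (All.map ¬outside⇒inside (Allₚ.all-filter (¬? ∘ outside?) S)) ⟩
    length A + length F ∸ length A      ≡⟨ m+n∸m≡n (length A) (length F) ⟩
    length F                            ≤⟨ |F|≤K ⟩
    K                                   ∎
    where open ≤-Reasoning
  Kp<|S′| : K * p < length (filter outside? S)
  Kp<|S′| = +-cancelʳ-< K (K * p) _ (begin-strict
    K * p + K                                ≡⟨ +-comm (K * p) K ⟩
    K + K * p                                ≡⟨ sym (*-suc K p) ⟩
    K * suc p                                <⟨ K[1+p]<|S| ⟩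
    length S                                 ≡⟨ sym (length-filter+filter¬ outside? S) ⟩
    length (filter outside? S) + length T    ≤⟨ +-monoʳ-≤ _ |T|≤K ⟩
    length (filter outside? S) + K           ∎)
    where open ≤-Reasoning
... | s , s∈S′ , steps′ = s , s∈S , insertFixedPoint s π₁ , insertFixedPoint-step K A F C mask |F|≤K |mask|≡ s outside , steps′
  where
  s∈S = proj₁ (∈-filter⁻ (outsideWindow? (length A) (length F)) {xs = S} s∈S′)
  outside = proj₂ (∈-filter⁻ (outsideWindow? (length A) (length F)) {xs = S} s∈S′)

-- Few misplaced entries

HasFixedRun : ℕ → ℕ → List ℕ → Set
HasFixedRun R j xs = ∃ λ pre → ∃ λ post → xs ≡ pre ++ range (j + length pre) R ++ post

HasFixedRun-++ : ∀ R j ys xs → HasFixedRun R (j + length ys) xs → HasFixedRun R j (ys ++ xs)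
HasFixedRun-++ R j []       xs run = subst (λ i → HasFixedRun R i xs) (+-identityʳ j) run
HasFixedRun-++ R j (y ∷ ys) xs run with HasFixedRun-++ R (suc j) ys xs (subst (λ i → HasFixedRun R i xs) (+-suc j (length ys)) run)
... | pre , post , eq = y ∷ pre , post , cong (y ∷_) (trans eq (cong (λ i → pre ++ range i R ++ post) (sym (+-suc j (length pre)))))

fixedRun-or-short′ : ∀ R j r xs → r < R →
  HasFixedRun R j (range j r ++ xs) ⊎ r + length xs < suc (misplaced (j + r) xs) * R
fixedRun-or-short′ R j r [] r<R = inj₂ (subst₂ _<_ (sym (+-identityʳ r)) (sym (+-identityʳ R)) r<R)
fixedRun-or-short′ R j r (x ∷ xs) r<R with x ≟ j + r
... | yes refl with suc r <? R
fixedRun-or-short′ R j r (.(j + r) ∷ xs) r<R | yes refl | yes 1+r<R with fixedRun-or-short′ R j (suc r) xs 1+r<R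
... | inj₁ (pre , post , eq) = inj₁ (pre , post , trans (range-∷ʳ j r xs) eq)
... | inj₂ short = inj₂ (subst₂ _<_ (sym (+-suc r (length xs))) (cong (λ m → suc m * R) same-misplaced) short)
  where
  same-misplaced : misplaced (j + suc r) xs ≡ misplaced (j + r) (j + r ∷ xs)
  same-misplaced = trans (cong (λ i → misplaced i xs) (+-suc j r))
                         (sym (countAt-∷-no misplaced? (j + r) (j + r) xs (λ x≢x → x≢x refl)))
fixedRun-or-short′ R j r (.(j + r) ∷ xs) r<R | yes refl | no 1+r≮R with ≤-antisym r<R (≮⇒≥ 1+r≮R)
... | refl = inj₁ ([] , xs , trans (range-∷ʳ j r xs) (cong (λ i → range i (suc r) ++ xs) (sym (+-identityʳ j))))
fixedRun-or-short′ R j r (x ∷ xs) r<R | no x≢j+r with fixedRun-or-short′ R (suc (j + r)) 0 xs (≤-trans z<s r<R)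
... | inj₁ run = inj₁ (HasFixedRun-++ R j (range j r) (x ∷ xs) (HasFixedRun-++ R (j + length (range j r)) (x ∷ []) xs run′))
  where
  position : suc (j + r) ≡ j + length (range j r) + 1
  position = trans (+-comm 1 (j + r)) (cong (λ k → j + k + 1) (sym (length-range j r)))
  run′ = subst (λ i → HasFixedRun R i xs) position run
... | inj₂ short = inj₂ (begin-strict
  r + length (x ∷ xs)                    ≡⟨ +-suc r (length xs) ⟩
  suc r + length xs                      <⟨ +-mono-≤-< r<R short′ ⟩
  R + suc m * R                          ≡⟨ cong (λ n → suc n * R) (sym (countAt-∷-yes misplaced? (j + r) x xs x≢j+r)) ⟩
  suc (misplaced (j + r) (x ∷ xs)) * R   ∎)
  where
  open ≤-Reasoning
  m = misplaced (suc (j + r)) xs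
  short′ : length xs < suc m * R
  short′ = subst (λ i → length xs < suc (misplaced i xs) * R) (+-identityʳ (suc (j + r))) short

fixedRun-or-short : ∀ R xs → 0 < R → HasFixedRun R 0 xs ⊎ length xs < suc (misplaced 0 xs) * R
fixedRun-or-short R xs 0<R = fixedRun-or-short′ R 0 0 xs 0<R

erase-run : ∀ pre m post → let a = length pre in
  erase pre a (range (suc a) m ++ post) ≡ map (punchOut a) pre ++ range a m ++ map (punchOut a) post
erase-run pre m post = begin
  map (punchOut a) (pre ++ range (suc a) m ++ post)
    ≡⟨ map-++ (punchOut a) pre _ ⟩
  map (punchOut a) pre ++ map (punchOut a) (range (suc a) m ++ post)
    ≡⟨ cong (map (punchOut a) pre ++_) (map-++ (punchOut a) (range (suc a) m) post) ⟩
  map (punchOut a) pre ++ map (punchOut a) (range (suc a) m) ++ map (punchOut a) post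
    ≡⟨ cong (λ R → map (punchOut a) pre ++ R ++ map (punchOut a) post) (map-punchOut-above a (suc a) m ≤-refl) ⟩
  map (punchOut a) pre ++ range a m ++ map (punchOut a) post ∎
  where
  open ≡-Reasoning
  a = length pre

insertFixedPoint-eraseRun : ∀ pre m post → IsPerm (pre ++ range (length pre) (suc m) ++ post) →
  ∀ s → s ∈ range (length pre) (suc m) →
  insertFixedPoint s (erase pre (length pre) (range (suc (length pre)) m ++ post)) ≡ pre ++ range (length pre) (suc m) ++ post
insertFixedPoint-eraseRun pre m post σ-perm s s∈run = begin
  insertFixedPoint s τ               ≡⟨ cong (λ i → insertFixedPoint i τ) (sym (m+[n∸m]≡n a≤s)) ⟩
  insertFixedPoint (a + (s ∸ a)) τ   ≡⟨ subst (λ τ′ → insertFixedPoint (a + (s ∸ a)) τ′ ≡ insertFixedPoint a τ′) (sym τ≡)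
                                         (insertFixedPoint-alongRun X W a m (length-map (punchOut a) pre)
                                            (subst IsPerm τ≡ τ-perm) (s ∸ a) s-a≤m) ⟩
  insertFixedPoint a τ               ≡⟨ insertFixedPoint-erase pre rest (proj₁ (erase-isPerm pre a rest σ-perm)) ⟩
  pre ++ a ∷ rest                    ∎
  where
  open ≡-Reasoning
  a = length pre
  rest = range (suc a) m ++ post
  τ = erase pre a rest
  τ-perm = proj₂ (erase-isPerm pre a rest σ-perm)
  X = map (punchOut a) pre
  W = map (punchOut a) post
  τ≡ = erase-run pre m post
  a≤s = proj₁ (∈-range⁻ a (suc m) s∈run)
  s-a≤m : s ∸ a ≤ m
  s-a≤m = s≤s⁻¹ (subst (s ∸ a <_) (m+n∸m≡n a (suc m)) (∸-monoˡ-< (proj₂ (∈-range⁻ a (suc m) s∈run)) a≤s))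

fixedRun-outside : ∀ K p pre post → let σ = pre ++ range (length pre) (suc (K * p)) ++ post in
  IsPerm σ → ¬ InC K p σ → StrictPatternOutside K p σ
fixedRun-outside K p pre post σ-perm σ∉C =
  τ , proj₂ (erase-isPerm pre a rest σ-perm) , erase-isPattern pre a rest (proj₁ (erase-isPerm pre a rest σ-perm)) ,
  length-erase pre a rest , τ∉C
  where
  a = length pre
  m = K * p
  rest = range (suc a) m ++ post
  τ = erase pre a rest
  τ∉C : ¬ InC K p τ
  τ∉C (n , steps) with Steps-insertFixedPoint K p steps (range a (suc m)) (range-sorted a (suc m))
                         (subst (m <_) (sym (length-range a (suc m))) ≤-refl)
  ... | s , s∈run , steps′ =
    σ∉C (suc n , subst₂ (Steps K p) identity-insert (insertFixedPoint-eraseRun pre m post σ-perm s s∈run) steps′)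
    where
    s≤n : s ≤ n
    s≤n = begin
      s                                           ≤⟨ s≤s⁻¹ (subst (s <_) (+-suc a m) (proj₂ (∈-range⁻ a (suc m) s∈run))) ⟩
      a + m                                       ≤⟨ +-monoʳ-≤ a (m≤m+n m (length post)) ⟩
      a + (m + length post)                       ≡⟨ cong (λ k → a + (k + length post)) (sym (length-range (suc a) m)) ⟩
      a + (length (range (suc a) m) + length post) ≡⟨ sym (length-++₃ pre (range (suc a) m) post) ⟩
      length (pre ++ rest)                        ≡⟨ sym (length-map (punchOut a) (pre ++ rest)) ⟩
      length τ                                    ≡⟨ length-steps K p steps ⟩
      length (identity n)                         ≡⟨ length-upTo n ⟩
      n                                           ∎
      where open ≤-Reasoning
    identity-insert : insertFixedPoint s (identity n) ≡ identity (suc n)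
    identity-insert = trans (cong (insertFixedPoint s) (upTo≡range n))
                            (trans (insertFixedPoint-range s≤n) (sym (upTo≡range (suc n))))

beyond-bound : ∀ m n → (m + 2) ^ 2 ∸ 2 < n → m + 3 ≤ n × suc m * suc m ≤ n
beyond-bound m n bound<n =
  ≤-trans (≤-reflexive (+-suc m 2)) (≤-trans (s≤s (m≤m+n (m + 2) (m * (m + 3)))) (subst (_< n) split₁ bound<n)) ,
  ≤-trans (m≤m+n (suc m * suc m) (suc (2 * m))) (<⇒≤ (subst (_< n) split₂ bound<n))
  where
  -- (x + 2) ^ 2 unfolds to the left-hand sides below; solve-∀ does not accept _^_.
  square₁ : ∀ x → (x + 2) * ((x + 2) * 1) ≡ 2 + ((x + 2) + x * (x + 3))
  square₁ = solve-∀
  square₂ : ∀ x → (x + 2) * ((x + 2) * 1) ≡ 2 + (suc x * suc x + suc (2 * x))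
  square₂ = solve-∀
  split₁ = cong (_∸ 2) (square₁ m)
  split₂ = cong (_∸ 2) (square₂ m)

proposition2 : (K p : ℕ) → 2 ≤ K → 1 ≤ p →
    (σ : List ℕ) → IsPerm σ → ¬ InC K p σ →
    (length σ ≤ (K * p + 2) ^ 2 ∸ 2)
    ⊎ (∃ λ τ → IsPerm τ × IsPattern τ σ × length τ < length σ × ¬ InC K p τ)
proposition2 K p _ _ σ σ-perm σ∉C with length σ ≤? (K * p + 2) ^ 2 ∸ 2
... | yes small = inj₁ small
... | no  large with beyond-bound (K * p) (length σ) (≰⇒> large)
...   | Kp+3≤n , [1+Kp]²≤n with K * p <? misplaced 0 σ
...     | yes many = inj₂ (manyMisplaced-outside K p σ σ-perm many Kp+3≤n)
...     | no  few with fixedRun-or-short (suc (K * p)) σ z<s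
...       | inj₁ (pre , post , refl) = inj₂ (fixedRun-outside K p pre post σ-perm σ∉C)
...       | inj₂ short = ⊥-elim (<⇒≱ short (≤-trans (*-monoˡ-≤ (suc (K * p)) (s≤s (≮⇒≥ few))) [1+Kp]²≤n))
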